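{- Let $\Gamma\subseteq\Sigma$ be alphabets, $H$ a set of hypotheses over $\Sigma$ and $H'$ a set of hypotheses over $\Gamma$. Suppose $H$ reduces to $H'$. If $\mathsf{KA}_{H'}$ is complete, then so is $\mathsf{KA}_H$.
   Context: Regular expressions $T(X)$ over an alphabet $X$: $e,f::=e+f\mid e\cdot f\mid e^*\mid 0\mid 1\mid a$ ($a\in X$), with usual language $\llbracket e\rrbracket$. Kleene algebra axioms: idempotent semiring axioms plus $1+xx^*\le x^*$, $x+yz\le z\Rightarrow y^*x\le z$, $x+yz\le y\Rightarrow xz^*\le y$. A hypothesis is a pair of regular expressions $e\le f$. $\mathsf{KA}_H\vdash e=f$ means derivable in equational logic from all instances of the Kleene algebra axioms and the hypotheses in $H$, letters being constants (no substitution rule); $\mathsf{KA}_H\vdash H'$ means $\mathsf{KA}_H\vdash e\le f$ for all $e\le f\in H'$. The $H$-closure $H^\star(L)$ is the smallest language containing $L$ such that for all $e\le f\in H$ and words $u,v$, $u\llbracket f\rrbracket v\subseteq H^\star(L)$ implies $u\llbracket e\rrbracket v\subseteq H^\star(L)$. $\mathsf{KA}_H$ is complete if for all expressions $e,f$ (over its alphabet), $H^\star(\llbracket e\rrbracket)=H^\star(\llbracket f\rrbracket)$ implies $\mathsf{KA}_H\vdash e=f$. $H$ reduces to $H'$ if (1) $\mathsf{KA}_H\vdash H'$ and there is a map $r:T(\Sigma)\to T(\Gamma)$ such that for all $e\in T(\Sigma)$: (2) $\mathsf{KA}_H\vdash e=r(e)$, and (3) $H^\star(\llbracket e\rrbracket)\cap\Gamma^*\subseteq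 H'^\star(\llbracket r(e)\rrbracket)$. -}

module Defs where

open import Data.List using (List; []; _∷_; _++_; map)
open import Data.Product using (Σ; _×_; _,_; ∃)

data Exp (X : Set) : Set where
  _⊕_ : Exp X → Exp X → Exp X
  _⊙_ : Exp X → Exp X → Exp X
  _⋆  : Exp X → Exp X
  𝟘   : Exp X
  𝟙   : Exp X
  lit : X → Exp X

infixl 6 _⊕_
infixl 7 _⊙_
infix  8 _⋆

mapExp : {X Y : Set} → (X → Y) → Exp X → Exp Y
mapExp g (e ⊕ f) = mapExp g e ⊕ mapExp g f
mapExp g (e ⊙ f) = mapExp g e ⊙ mapExp g f
mapExp g (e ⋆)   = mapExp g e ⋆
mapExp g 𝟘       = 𝟘
mapExp g 𝟙       = 𝟙
mapExp g (lit a) = lit (g a)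

Lang : Set → Set₁
Lang X = List X → Set

data ⟦_⟧ {X : Set} : Exp X → Lang X where
  inl  : ∀ {e f w} → ⟦ e ⟧ w → ⟦ e ⊕ f ⟧ w
  inr  : ∀ {e f w} → ⟦ f ⟧ w → ⟦ e ⊕ f ⟧ w
  cat  : ∀ {e f u v} → ⟦ e ⟧ u → ⟦ f ⟧ v → ⟦ e ⊙ f ⟧ (u ++ v)
  nil  : ∀ {e} → ⟦ e ⋆ ⟧ []
  more : ∀ {e u v} → ⟦ e ⟧ u → ⟦ e ⋆ ⟧ v → ⟦ e ⋆ ⟧ (u ++ v)
  one  : ⟦ 𝟙 ⟧ []
  sym  : ∀ {a} → ⟦ lit a ⟧ (a ∷ [])

-- A set of hypotheses over X: a predicate on pairs (e , f), read as e ≤ f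
Hyps : Set → Set₁
Hyps X = Exp X → Exp X → Set

-- H-closure H⋆(L): the least language containing L and such that for every
-- (e ≤ f) ∈ H and words u v, u⟦f⟧v ⊆ H⋆(L) implies u⟦e⟧v ⊆ H⋆(L).
data Closure {X : Set} (H : Hyps X) (L : Lang X) : Lang X where
  base : ∀ {w} → L w → Closure H L w
  step : ∀ {e f u v w} → H e f → ⟦ e ⟧ w
       → (∀ x → ⟦ f ⟧ x → Closure H L (u ++ (x ++ v)))
       → Closure H L (u ++ (w ++ v))

_≐_ : {X : Set} → Lang X → Lang X → Set
L ≐ K = (∀ w → L w → K w) × (∀ w → K w → L w)

infix 4 _⊢_≈_ _⊢_≤_
data _⊢_≈_ {X : Set} (H : Hyps X) : Exp X → Exp X → Set

_⊢_≤_ : {X : Set} → Hyps X → Exp X → Exp X → Set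
H ⊢ e ≤ f = H ⊢ e ⊕ f ≈ f

data _⊢_≈_ {X} H where
  refl    : ∀ {e} → H ⊢ e ≈ e
  sym     : ∀ {e f} → H ⊢ e ≈ f → H ⊢ f ≈ e
  trans   : ∀ {e f g} → H ⊢ e ≈ f → H ⊢ f ≈ g → H ⊢ e ≈ g
  ⊕-cong  : ∀ {e e' f f'} → H ⊢ e ≈ e' → H ⊢ f ≈ f' → H ⊢ e ⊕ f ≈ e' ⊕ f'
  ⊙-cong  : ∀ {e e' f f'} → H ⊢ e ≈ e' → H ⊢ f ≈ f' → H ⊢ e ⊙ f ≈ e' ⊙ f'
  ⋆-cong  : ∀ {e e'} → H ⊢ e ≈ e' → H ⊢ e ⋆ ≈ e' ⋆
  ⊕-assoc : ∀ {e f g} → H ⊢ (e ⊕ f) ⊕ g ≈ e ⊕ (f ⊕ g)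
  ⊕-comm  : ∀ {e f} → H ⊢ e ⊕ f ≈ f ⊕ e
  ⊕-idem  : ∀ {e} → H ⊢ e ⊕ e ≈ e
  ⊕-zero  : ∀ {e} → H ⊢ e ⊕ 𝟘 ≈ e
  ⊙-assoc : ∀ {e f g} → H ⊢ (e ⊙ f) ⊙ g ≈ e ⊙ (f ⊙ g)
  ⊙-oneˡ  : ∀ {e} → H ⊢ 𝟙 ⊙ e ≈ e
  ⊙-oneʳ  : ∀ {e} → H ⊢ e ⊙ 𝟙 ≈ e
  ⊙-zeroˡ : ∀ {e} → H ⊢ 𝟘 ⊙ e ≈ 𝟘
  ⊙-zeroʳ : ∀ {e} → H ⊢ e ⊙ 𝟘 ≈ 𝟘
  distˡ   : ∀ {e f g} → H ⊢ e ⊙ (f ⊕ g) ≈ (e ⊙ f) ⊕ (e ⊙ g)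
  distʳ   : ∀ {e f g} → H ⊢ (f ⊕ g) ⊙ e ≈ (f ⊙ e) ⊕ (g ⊙ e)
  ⋆-unfold : ∀ {x} → H ⊢ 𝟙 ⊕ x ⊙ (x ⋆) ≤ x ⋆
  ⋆-indˡ   : ∀ {x y z} → H ⊢ x ⊕ y ⊙ z ≤ z → H ⊢ (y ⋆) ⊙ x ≤ z
  ⋆-indʳ   : ∀ {x y z} → H ⊢ x ⊕ y ⊙ z ≤ y → H ⊢ x ⊙ (z ⋆) ≤ y
  hyp      : ∀ {e f} → H e f → H ⊢ e ≤ f

Complete : {X : Set} → Hyps X → Set
Complete {X} H = ∀ (e f : Exp X) →
  Closure H ⟦ e ⟧ ≐ Closure H ⟦ f ⟧ → H ⊢ e ≈ f

Reduces : {S G : Set} (ι : G → S) → Hyps S → Hyps G → Set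
Reduces {S} {G} ι H H' =
  (∀ e f → H' e f → H ⊢ mapExp ι e ≤ mapExp ι f)
  × Σ (Exp S → Exp G) (λ r →
      (∀ e → H ⊢ e ≈ mapExp ι (r e))
    × (∀ e (w : List G) → Closure H ⟦ e ⟧ (map ι w) → Closure H' ⟦ r e ⟧ w))

{-# OPTIONS --safe #-}
-- Derivability is sound for the closure semantics: H ⊢ e ≈ f implies
-- H⋆⟦e⟧ = H⋆⟦f⟧. Renaming along ι maps H'-derivations to H-derivations
-- (by the first reduction condition) and H'-closures into H-closures. So if
-- H⋆⟦e⟧ = H⋆⟦f⟧, then for w ∈ H'⋆⟦r e⟧ we get ι w ∈ H⋆⟦ι (r e)⟧ = H⋆⟦e⟧
-- = H⋆⟦f⟧, hence w ∈ H'⋆⟦r f⟧ by the third condition. Completeness of KA_H'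
-- yields H' ⊢ r e ≈ r f, which transported along ι and combined with
-- H ⊢ e ≈ ι (r e) and H ⊢ f ≈ ι (r f) gives H ⊢ e ≈ f.
module Submission where

open import Defs
open import Function.Definitions using (Injective)
open import Relation.Binary.PropositionalEquality using (_≡_)
import Relation.Binary.PropositionalEquality as ≡
open import Data.List using (List; []; _∷_; _++_; map)
open import Data.List.Properties using (++-assoc; ++-identityʳ; map-++)
open import Data.Product using (Σ-syntax; _×_; _,_; proj₁; proj₂)

module ClosureProperties {X : Set} (H : Hyps X) where

  open ≡.≡-Reasoning

  ++-reassoc : (u u′ x v′ v : List X) →
               u ++ ((u′ ++ (x ++ v′)) ++ v) ≡ (u ++ u′) ++ (x ++ (v′ ++ v))
  ++-reassoc u u′ x v′ v = begin
    u ++ ((u′ ++ (x ++ v′)) ++ v)  ≡⟨ ≡.cong (u ++_) (++-assoc u′ (x ++ v′) v) ⟩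
    u ++ (u′ ++ ((x ++ v′) ++ v))  ≡⟨ ≡.cong (λ y → u ++ (u′ ++ y)) (++-assoc x v′ v) ⟩
    u ++ (u′ ++ (x ++ (v′ ++ v)))  ≡⟨ ++-assoc u u′ (x ++ (v′ ++ v)) ⟨
    (u ++ u′) ++ (x ++ (v′ ++ v))  ∎

  closure-inContext : ∀ {A K : Lang X} {u v y} →
                      (∀ z → A z → Closure H K (u ++ (z ++ v))) →
                      Closure H A y → Closure H K (u ++ (y ++ v))
  closure-inContext g (base a) = g _ a
  closure-inContext {u = u} {v} g (step {u = u′} {v′} {w} h d k) =
    ≡.subst (Closure H _) (≡.sym (++-reassoc u u′ w v′ v))
      (step {u = u ++ u′} {v = v′ ++ v} h d λ x fx →
        ≡.subst (Closure H _) (++-reassoc u u′ x v′ v) (closure-inContext {u = u} {v} g (k x fx)))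

  closure-bind : ∀ {A B : Lang X} {w} →
                 (∀ w → A w → Closure H B w) → Closure H A w → Closure H B w
  closure-bind {w = w} g c =
    ≡.subst (Closure H _) (++-identityʳ w)
      (closure-inContext {u = []} {v = []}
        (λ z a → ≡.subst (Closure H _) (≡.sym (++-identityʳ z)) (g z a)) c)

  closure-++ : ∀ {A B C : Lang X} {y z} →
               (∀ {y z} → A y → B z → C (y ++ z)) →
               Closure H A y → Closure H B z → Closure H C (y ++ z)
  closure-++ {y = y} {z} m ca cb =
    ≡.subst (Closure H _) (≡.cong (y ++_) (++-identityʳ z))
      (closure-inContext {u = y} {v = []}
        (λ z′ b → ≡.subst (Closure H _) (≡.cong (y ++_) (≡.sym (++-identityʳ z′)))
          (closure-inContext {u = []} {v = z′} (λ _ a → base (m a b)) ca))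
        cb)

  infix 4 _⊑_
  _⊑_ : Exp X → Exp X → Set
  e ⊑ f = ∀ w → ⟦ e ⟧ w → Closure H ⟦ f ⟧ w

  ⊑-refl : ∀ {e} → e ⊑ e
  ⊑-refl _ = base

  ⊑-trans : ∀ {e f g} → e ⊑ f → f ⊑ g → e ⊑ g
  ⊑-trans p q w a = closure-bind q (p w a)

  ⊕-mono : ∀ {e e′ f f′} → e ⊑ e′ → f ⊑ f′ → e ⊕ f ⊑ e′ ⊕ f′
  ⊕-mono p q _ (inl a) = closure-bind (λ _ a′ → base (inl a′)) (p _ a)
  ⊕-mono p q _ (inr b) = closure-bind (λ _ b′ → base (inr b′)) (q _ b)

  ⊙-mono : ∀ {e e′ f f′} → e ⊑ e′ → f ⊑ f′ → e ⊙ f ⊑ e′ ⊙ f′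
  ⊙-mono p q _ (cat a b) = closure-++ cat (p _ a) (q _ b)

  ⋆-mono : ∀ {e e′} → e ⊑ e′ → e ⋆ ⊑ e′ ⋆
  ⋆-mono p _ nil        = base nil
  ⋆-mono p _ (more a s) = closure-++ more (p _ a) (⋆-mono p _ s)

  ⊑-join : ∀ {e f} → e ⊑ f → e ⊕ f ⊑ f
  ⊑-join p _ (inl a) = p _ a
  ⊑-join p _ (inr b) = base b

  ⊑-joinʳ : ∀ {e f} → f ⊑ e ⊕ f
  ⊑-joinʳ _ b = base (inr b)

  ⊑-unjoin : ∀ {e f} → e ⊕ f ⊑ f → e ⊑ f
  ⊑-unjoin p _ a = p _ (inl a)

  ⋆-indˡ-sound : ∀ {x y z} → x ⊕ y ⊙ z ⊑ z → y ⋆ ⊙ x ⊑ z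
  ⋆-indˡ-sound {x} {y} {z} p _ (cat s a) = go s a
    where
    go : ∀ {u v} → ⟦ y ⋆ ⟧ u → ⟦ x ⟧ v → Closure H ⟦ z ⟧ (u ++ v)
    go nil a = p _ (inl a)
    go {v = v} (more {u = u₁} {u₂} b s) a =
      ≡.subst (Closure H _) (≡.sym (++-assoc u₁ u₂ v))
        (closure-bind p (closure-++ (λ b c → inr (cat b c)) (base b) (go s a)))

  ⋆-indʳ-sound : ∀ {x y z} → x ⊕ y ⊙ z ⊑ y → x ⊙ z ⋆ ⊑ y
  ⋆-indʳ-sound {x} {y} {z} p _ (cat a s) = go s (p _ (inl a))
    where
    go : ∀ {u v} → ⟦ z ⋆ ⟧ v → Closure H ⟦ y ⟧ u → Closure H ⟦ y ⟧ (u ++ v)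
    go {u} nil c = ≡.subst (Closure H _) (≡.sym (++-identityʳ u)) c
    go {u} (more {u = v₁} {v₂} b s) c =
      ≡.subst (Closure H _) (++-assoc u v₁ v₂)
        (go s (closure-bind p (closure-++ (λ c b → inr (cat c b)) c (base b))))

  hyp-sound : ∀ {e f} → H e f → e ⊑ f
  hyp-sound h w a =
    ≡.subst (Closure H _) (++-identityʳ w)
      (step {u = []} {v = []} h a λ x b →
        ≡.subst (Closure H _) (≡.sym (++-identityʳ x)) (base b))

  soundness : ∀ {e f} → H ⊢ e ≈ f → e ⊑ f × f ⊑ e
  soundness-≤ : ∀ {e f} → H ⊢ e ≤ f → e ⊑ f
  soundness-≤ p = ⊑-unjoin (proj₁ (soundness p))

  soundness refl        = ⊑-refl , ⊑-refl
  soundness (sym p)     = proj₂ (soundness p) , proj₁ (soundness p)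
  soundness (trans p q) =
    ⊑-trans (proj₁ (soundness p)) (proj₁ (soundness q)) ,
    ⊑-trans (proj₂ (soundness q)) (proj₂ (soundness p))
  soundness (⊕-cong p q) =
    ⊕-mono (proj₁ (soundness p)) (proj₁ (soundness q)) ,
    ⊕-mono (proj₂ (soundness p)) (proj₂ (soundness q))
  soundness (⊙-cong p q) =
    ⊙-mono (proj₁ (soundness p)) (proj₁ (soundness q)) ,
    ⊙-mono (proj₂ (soundness p)) (proj₂ (soundness q))
  soundness (⋆-cong p) = ⋆-mono (proj₁ (soundness p)) , ⋆-mono (proj₂ (soundness p))
  soundness ⊕-assoc =
    (λ { _ (inl (inl a)) → base (inl a)
       ; _ (inl (inr b)) → base (inr (inl b))
       ; _ (inr c)       → base (inr (inr c)) }) ,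
    (λ { _ (inl a)       → base (inl (inl a))
       ; _ (inr (inl b)) → base (inl (inr b))
       ; _ (inr (inr c)) → base (inr c) })
  soundness ⊕-comm =
    (λ { _ (inl a) → base (inr a) ; _ (inr b) → base (inl b) }) ,
    (λ { _ (inl a) → base (inr a) ; _ (inr b) → base (inl b) })
  soundness ⊕-idem = ⊑-join ⊑-refl , (λ _ a → base (inl a))
  soundness ⊕-zero = (λ { _ (inl a) → base a ; _ (inr ()) }) , (λ _ a → base (inl a))
  soundness ⊙-assoc =
    (λ { _ (cat {v = w} (cat {u = u} {v} a b) c) →
           ≡.subst (Closure H _) (≡.sym (++-assoc u v w)) (base (cat a (cat b c))) }) ,
    (λ { _ (cat {u = u} a (cat {u = v} {w} b c)) →
           ≡.subst (Closure H _) (++-assoc u v w) (base (cat (cat a b) c)) })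
  soundness ⊙-oneˡ = (λ { _ (cat one a) → base a }) , (λ _ a → base (cat one a))
  soundness ⊙-oneʳ =
    (λ { _ (cat {u = u} a one) → ≡.subst (Closure H _) (≡.sym (++-identityʳ u)) (base a) }) ,
    (λ w a → ≡.subst (Closure H _) (++-identityʳ w) (base (cat a one)))
  soundness ⊙-zeroˡ = (λ { _ (cat () _) }) , (λ _ ())
  soundness ⊙-zeroʳ = (λ { _ (cat _ ()) }) , (λ _ ())
  soundness distˡ =
    (λ { _ (cat a (inl b)) → base (inl (cat a b)) ; _ (cat a (inr c)) → base (inr (cat a c)) }) ,
    (λ { _ (inl (cat a b)) → base (cat a (inl b)) ; _ (inr (cat a c)) → base (cat a (inr c)) })
  soundness distʳ =
    (λ { _ (cat (inl a) c) → base (inl (cat a c)) ; _ (cat (inr b) c) → base (inr (cat b c)) }) ,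
    (λ { _ (inl (cat a c)) → base (cat (inl a) c) ; _ (inr (cat b c)) → base (cat (inr b) c) })
  soundness ⋆-unfold =
    ⊑-join (λ { _ (inl one) → base nil ; _ (inr (cat a s)) → base (more a s) }) , ⊑-joinʳ
  soundness (⋆-indˡ p) = ⊑-join (⋆-indˡ-sound (soundness-≤ p)) , ⊑-joinʳ
  soundness (⋆-indʳ p) = ⊑-join (⋆-indʳ-sound (soundness-≤ p)) , ⊑-joinʳ
  soundness (hyp h)    = ⊑-join (hyp-sound h) , ⊑-joinʳ

module Renaming {S G : Set} (ι : G → S) where

  ⟦⟧-map : ∀ {e : Exp G} {w} → ⟦ e ⟧ w → ⟦ mapExp ι e ⟧ (map ι w)
  ⟦⟧-map (inl a) = inl (⟦⟧-map a)
  ⟦⟧-map (inr b) = inr (⟦⟧-map b)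
  ⟦⟧-map (cat {u = u} {v} a b) =
    ≡.subst ⟦ _ ⟧ (≡.sym (map-++ ι u v)) (cat (⟦⟧-map a) (⟦⟧-map b))
  ⟦⟧-map nil = nil
  ⟦⟧-map (more {u = u} {v} a s) =
    ≡.subst ⟦ _ ⟧ (≡.sym (map-++ ι u v)) (more (⟦⟧-map a) (⟦⟧-map s))
  ⟦⟧-map one = one
  ⟦⟧-map sym = sym

  -- The preimage is read off the membership proof, so ι need not be injective.
  ⟦⟧-map⁻¹ : ∀ (e : Exp G) {z} → ⟦ mapExp ι e ⟧ z → Σ[ x ∈ List G ] map ι x ≡ z × ⟦ e ⟧ x
  ⟦⟧-map⁻¹ (e ⊕ f) (inl a) with ⟦⟧-map⁻¹ e a
  ... | x , eq , a′ = x , eq , inl a′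
  ⟦⟧-map⁻¹ (e ⊕ f) (inr b) with ⟦⟧-map⁻¹ f b
  ... | x , eq , b′ = x , eq , inr b′
  ⟦⟧-map⁻¹ (e ⊙ f) (cat a b) with ⟦⟧-map⁻¹ e a | ⟦⟧-map⁻¹ f b
  ... | x , ≡.refl , a′ | y , ≡.refl , b′ = x ++ y , map-++ ι x y , cat a′ b′
  ⟦⟧-map⁻¹ (e ⋆) nil = [] , ≡.refl , nil
  ⟦⟧-map⁻¹ (e ⋆) (more a s) with ⟦⟧-map⁻¹ e a | ⟦⟧-map⁻¹ (e ⋆) s
  ... | x , ≡.refl , a′ | y , ≡.refl , s′ = x ++ y , map-++ ι x y , more a′ s′
  ⟦⟧-map⁻¹ 𝟘 ()
  ⟦⟧-map⁻¹ 𝟙 one = [] , ≡.refl , one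
  ⟦⟧-map⁻¹ (lit a) sym = a ∷ [] , ≡.refl , sym

  module _ (H : Hyps S) (H′ : Hyps G)
           (H⊢H′ : ∀ e f → H′ e f → H ⊢ mapExp ι e ≤ mapExp ι f) where

    open ClosureProperties H

    ⊢-map : ∀ {e f} → H′ ⊢ e ≈ f → H ⊢ mapExp ι e ≈ mapExp ι f
    ⊢-map refl         = refl
    ⊢-map (sym p)      = sym (⊢-map p)
    ⊢-map (trans p q)  = trans (⊢-map p) (⊢-map q)
    ⊢-map (⊕-cong p q) = ⊕-cong (⊢-map p) (⊢-map q)
    ⊢-map (⊙-cong p q) = ⊙-cong (⊢-map p) (⊢-map q)
    ⊢-map (⋆-cong p)   = ⋆-cong (⊢-map p)
    ⊢-map ⊕-assoc      = ⊕-assoc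
    ⊢-map ⊕-comm       = ⊕-comm
    ⊢-map ⊕-idem       = ⊕-idem
    ⊢-map ⊕-zero       = ⊕-zero
    ⊢-map ⊙-assoc      = ⊙-assoc
    ⊢-map ⊙-oneˡ       = ⊙-oneˡ
    ⊢-map ⊙-oneʳ       = ⊙-oneʳ
    ⊢-map ⊙-zeroˡ      = ⊙-zeroˡ
    ⊢-map ⊙-zeroʳ      = ⊙-zeroʳ
    ⊢-map distˡ        = distˡ
    ⊢-map distʳ        = distʳ
    ⊢-map ⋆-unfold     = ⋆-unfold
    ⊢-map (⋆-indˡ p)   = ⋆-indˡ (⊢-map p)
    ⊢-map (⋆-indʳ p)   = ⋆-indʳ (⊢-map p)
    ⊢-map (hyp {e} {f} h) = H⊢H′ e f h

    map-++³ : (u w v : List G) → map ι (u ++ (w ++ v)) ≡ map ι u ++ (map ι w ++ map ι v)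
    map-++³ u w v = ≡.trans (map-++ ι u (w ++ v)) (≡.cong (map ι u ++_) (map-++ ι w v))

    closure-map : ∀ {e : Exp G} {w} → Closure H′ ⟦ e ⟧ w → Closure H ⟦ mapExp ι e ⟧ (map ι w)
    closure-map (base a) = base (⟦⟧-map a)
    closure-map {e} (step {e = e′} {f′} {u} {v} {w} h a k) =
      ≡.subst (Closure H _) (≡.sym (map-++³ u w v))
        (closure-inContext {u = map ι u} {v = map ι v} fill
          (soundness-≤ (H⊢H′ e′ f′ h) _ (⟦⟧-map a)))
      where
      fill : ∀ z → ⟦ mapExp ι f′ ⟧ z → Closure H ⟦ mapExp ι e ⟧ (map ι u ++ (z ++ map ι v))
      fill z b with ⟦⟧-map⁻¹ f′ b
      ... | x , ≡.refl , b′ = ≡.subst (Closure H _) (map-++³ u x v) (closure-map (k x b′))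

theorem2p11 : {S G : Set} (ι : G → S) → Injective _≡_ _≡_ ι
            → (H : Hyps S) (H' : Hyps G)
            → Reduces ι H H' → Complete H' → Complete H
theorem2p11 ι _ H H′ (H⊢H′ , r , e≈r[e] , r-preserves) H′-complete e f (e⊆f , f⊆e) =
  trans (e≈r[e] e) (trans (⊢-map H H′ H⊢H′ r[e]≈r[f]) (sym (e≈r[e] f)))
  where
  open Renaming ι
  open ClosureProperties H

  r-mono : ∀ {e f} → (∀ w → Closure H ⟦ e ⟧ w → Closure H ⟦ f ⟧ w)
         → ∀ w → Closure H′ ⟦ r e ⟧ w → Closure H′ ⟦ r f ⟧ w
  r-mono {e} {f} e⊆f w c =
    r-preserves f w (e⊆f _ (closure-bind (proj₂ (soundness (e≈r[e] e))) (closure-map H H′ H⊢H′ c)))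

  r[e]≈r[f] : H′ ⊢ r e ≈ r f
  r[e]≈r[f] = H′-complete (r e) (r f) (r-mono e⊆f , r-mono f⊆e)
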